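{- Let $G$ be a connected graph satisfying condition $\star$, and let $x$ be a vertex of $G$ of maximum degree. Let $H$ be the graph obtained from $G$ by adding a new vertex $w$ and the single edge $xw$. Then $H$ satisfies condition $\star$.
   Context: For a vertex $a$, $N(a)$ is the set of vertices adjacent to $a$ and $\overline{N(a)}=N(a)\cup\{a\}$. Condition $\star$ on a graph: for every pair $a,b$ of distinct nonadjacent vertices there is a vertex $c$ with $N(a)\cup N(b)\subseteq\overline{N(c)}$. -}

module Defs where

open import Data.Nat using (ℕ; suc; _≤_)
open import Data.Fin using (Fin; zero; suc)
open import Data.Bool using (Bool; true; false; T)
open import Data.List using (List; filter; length)
open import Data.List using () renaming (allFin to allFinL)
open import Data.Product using (∃; _×_)
open import Relation.Binary.PropositionalEquality using (_≡_)
open import Relation.Nullary using (¬_)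
open import Data.Fin using (_≟_)
open import Relation.Nullary.Decidable using (⌊_⌋)
open import Data.Bool using (_∧_)
open import Data.Empty using (⊥)
open import Data.Unit using (⊤)

record Graph (n : ℕ) : Set where
  field
    adj   : Fin n → Fin n → Bool
    sym   : ∀ a b → adj a b ≡ adj b a
    irrefl : ∀ a → adj a a ≡ false

open Graph public

_∼[_]_ : {n : ℕ} → Fin n → Graph n → Fin n → Set
a ∼[ G ] b = T (adj G a b)

InClosedNbhd : {n : ℕ} → Graph n → Fin n → Fin n → Set
InClosedNbhd G c v = (v ≡ c) ⊎' (v ∼[ G ] c)
  where
  open import Data.Sum renaming (_⊎_ to _⊎'_)

Star : {n : ℕ} → Graph n → Set
Star {n} G = ∀ (a b : Fin n) → ¬ (a ≡ b) → ¬ (a ∼[ G ] b) →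
  ∃ λ (c : Fin n) → ∀ (v : Fin n) →
    (v ∼[ G ] a → InClosedNbhd G c v) × (v ∼[ G ] b → InClosedNbhd G c v)

degree : {n : ℕ} → Graph n → Fin n → ℕ
degree {n} G a = length (filter (λ v → T? (adj G a v)) (allFinL n))
  where
  open import Data.Bool.Properties using (T?)

data Reach {n : ℕ} (G : Graph n) : Fin n → Fin n → Set where
  here : ∀ {a} → Reach G a a
  step : ∀ {a b c} → a ∼[ G ] b → Reach G b c → Reach G a c

Connected : {n : ℕ} → Graph n → Set
Connected {n} G = ∀ (a b : Fin n) → Reach G a b

MaxDegree : {n : ℕ} → Graph n → Fin n → Set
MaxDegree {n} G x = ∀ (y : Fin n) → degree G y ≤ degree G x

-- Pendant extension: vertex set Fin (suc n); the new vertex w is zero,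
-- old vertex v becomes suc v; the only new edge is w — suc x.
pendAdj : {n : ℕ} → Graph n → Fin n → Fin (suc n) → Fin (suc n) → Bool
pendAdj G x zero    zero    = false
pendAdj G x zero    (suc b) = ⌊ b ≟ x ⌋
pendAdj G x (suc a) zero    = ⌊ a ≟ x ⌋
pendAdj G x (suc a) (suc b) = adj G a b

addPendant : {n : ℕ} → (G : Graph n) → Fin n → Graph (suc n)
addPendant G x = record { adj = pendAdj G x ; sym = s ; irrefl = i }
  where
  open import Relation.Binary.PropositionalEquality using (refl)
  s : ∀ a b → pendAdj G x a b ≡ pendAdj G x b a
  s zero zero = refl
  s zero (suc b) = refl
  s (suc a) zero = refl
  s (suc a) (suc b) = Graph.sym G a b
  i : ∀ a → pendAdj G x a a ≡ false
  i zero = refl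
  i (suc a) = Graph.irrefl G a

-- If b ≠ x is not adjacent to x, then N(b) ⊆ N̄(x).  Otherwise take c given by ⋆
-- for x, b and a neighbour v of b outside N̄(x).  If c ~ x then N̄(x) ⊊ N̄(c),
-- v being the extra vertex; if c ≁ x then N(x) ⊆ N̄(c) already forces
-- N(x) ⊆ N(c), and v (or b, when v = c) lies in N(c) ∖ N(x).  Either way
-- deg c > deg x.  So in H the vertex x covers both x, b and w, b (or b itself
-- covers w, b when b ~ x), and pairs of old vertices keep their old witness.
module Submission where

open import Defs
open import Data.Nat using (ℕ; zero; suc; _+_; _≤_; _<_; z≤n; s≤s; s<s⁻¹)
open import Data.Nat.Properties using (≤-refl; +-mono-≤; +-mono-<-≤; +-mono-≤-<; +-suc; <⇒≱)
open import Data.Fin using (Fin; zero; suc; _≟_)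
open import Data.Bool using (Bool; true; false; T; _∨_)
open import Data.Bool.Properties using (T?)
open import Data.List using (filter; length; tabulate)
open import Data.Unit using (tt)
open import Data.Empty using (⊥-elim)
open import Data.Sum using (inj₁; inj₂; [_,_])
import Data.Sum as Sum
open import Data.Product using (∃; _×_; _,_; proj₁; proj₂)
open import Function using (_∘_; id; _⇔_; mk⇔; Equivalence)
open import Relation.Nullary using (¬_; yes; no; does)
open import Relation.Nullary.Decidable using (Dec; toWitness; fromWitness) renaming (map to Dec-map)
open import Relation.Binary.PropositionalEquality using (_≡_; _≢_; ≢-sym; refl; cong; subst; subst₂)

bit : Bool → ℕ
bit true  = 1
bit false = 0

bit-mono : ∀ {a b} → (T a → T b) → bit a ≤ bit b
bit-mono {false}         _   = z≤n
bit-mono {true}  {true}  _   = ≤-refl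
bit-mono {true}  {false} a⇒b = ⊥-elim (a⇒b tt)

bit-< : ∀ {a b} → ¬ T a → T b → bit a < bit b
bit-< {false} {true} _  _ = s≤s z≤n
bit-< {true}         ¬a _ = ⊥-elim (¬a tt)

count : ∀ {n} → (Fin n → Bool) → ℕ
count {zero}  p = 0
count {suc n} p = bit (p zero) + count (p ∘ suc)

length-filter-tabulate : ∀ {A : Set} n (f : Fin n → A) (p : A → Bool) →
  length (filter (T? ∘ p) (tabulate f)) ≡ count (p ∘ f)
length-filter-tabulate zero    f p = refl
length-filter-tabulate (suc n) f p with p (f zero)
... | true  = cong suc (length-filter-tabulate n (f ∘ suc) p)
... | false = length-filter-tabulate n (f ∘ suc) p

_⊆ᵇ_ : ∀ {n} → (Fin n → Bool) → (Fin n → Bool) → Set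
p ⊆ᵇ q = ∀ i → T (p i) → T (q i)

count-mono : ∀ {n} {p q : Fin n → Bool} → p ⊆ᵇ q → count p ≤ count q
count-mono {zero}  p⊆q = z≤n
count-mono {suc n} p⊆q = +-mono-≤ (bit-mono (p⊆q zero)) (count-mono (p⊆q ∘ suc))

count-mono-< : ∀ {n} {p q : Fin n → Bool} → p ⊆ᵇ q →
  ∀ j → ¬ T (p j) → T (q j) → count p < count q
count-mono-< p⊆q zero    ¬pj qj = +-mono-<-≤ (bit-< ¬pj qj) (count-mono (p⊆q ∘ suc))
count-mono-< p⊆q (suc j) ¬pj qj =
  +-mono-≤-< (bit-mono (p⊆q zero)) (count-mono-< (p⊆q ∘ suc) j ¬pj qj)

count-insert : ∀ {n} (p : Fin n → Bool) a → p a ≡ false →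
  count (λ i → does (i ≟ a) ∨ p i) ≡ suc (count p)
count-insert p zero    pa rewrite pa = refl
count-insert p (suc a) pa rewrite count-insert (p ∘ suc) a pa =
  +-suc (bit (p zero)) (count (p ∘ suc))

module _ {n : ℕ} (G : Graph n) where

  ∼-sym : ∀ {a b} → a ∼[ G ] b → b ∼[ G ] a
  ∼-sym {a} {b} = subst T (Graph.sym G a b)

  closedNbhd : Fin n → Fin n → Bool
  closedNbhd a v = does (v ≟ a) ∨ adj G a v

  closedNbhd-spec : ∀ a v → T (closedNbhd a v) ⇔ InClosedNbhd G a v
  closedNbhd-spec a v with v ≟ a
  ... | yes v≡a = mk⇔ (λ _ → inj₁ v≡a) (λ _ → tt)
  ... | no  v≢a = mk⇔ (inj₂ ∘ ∼-sym) [ ⊥-elim ∘ v≢a , ∼-sym ]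

  inClosedNbhd? : ∀ a v → Dec (InClosedNbhd G a v)
  inClosedNbhd? a v = Dec-map (closedNbhd-spec a v) (T? (closedNbhd a v))

  degree≡count : ∀ a → degree G a ≡ count (adj G a)
  degree≡count a = length-filter-tabulate n id (adj G a)

  count-closedNbhd : ∀ a → count (closedNbhd a) ≡ suc (degree G a)
  count-closedNbhd a rewrite degree≡count a = count-insert (adj G a) a (Graph.irrefl G a)

  degree-mono-< : ∀ {a c} → adj G a ⊆ᵇ adj G c →
    ∀ u → ¬ a ∼[ G ] u → c ∼[ G ] u → degree G a < degree G c
  degree-mono-< {a} {c} N⊆N u a≁u c∼u rewrite degree≡count a | degree≡count c =
    count-mono-< N⊆N u a≁u c∼u

  degree-mono-<-closed : ∀ {a c} → closedNbhd a ⊆ᵇ closedNbhd c →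
    ∀ u → ¬ InClosedNbhd G a u → InClosedNbhd G c u → degree G a < degree G c
  degree-mono-<-closed {a} {c} N̄⊆N̄ u u∉N̄a u∈N̄c =
    s<s⁻¹ (subst₂ _<_ (count-closedNbhd a) (count-closedNbhd c)
      (count-mono-< N̄⊆N̄ u (u∉N̄a ∘ Equivalence.to (closedNbhd-spec a u))
                          (Equivalence.from (closedNbhd-spec c u) u∈N̄c)))

  Covers : Fin n → Fin n → Set
  Covers c a = ∀ v → v ∼[ G ] a → InClosedNbhd G c v

  CommonCover : Fin n → Fin n → Set
  CommonCover a b = ∃ λ c → Covers c a × Covers c b

  covers-self : ∀ a → Covers a a
  covers-self a v = inj₂

  CommonCover-swap : ∀ {a b} → CommonCover a b → CommonCover b a
  CommonCover-swap (c , ca , cb) = c , cb , ca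

  Star⇒CommonCover : Star G → ∀ {a b} → a ≢ b → ¬ a ∼[ G ] b → CommonCover a b
  Star⇒CommonCover star {a} {b} a≢b a≁b with star a b a≢b a≁b
  ... | c , h = c , (λ v → proj₁ (h v)) , (λ v → proj₂ (h v))

  CommonCover⇒Star : (∀ a b → a ≢ b → ¬ a ∼[ G ] b → CommonCover a b) → Star G
  CommonCover⇒Star common a b a≢b a≁b with common a b a≢b a≁b
  ... | c , ca , cb = c , λ v → ca v , cb v

  covers-adjacent⇒degree-< : ∀ {a c} → c ∼[ G ] a → Covers c a →
    ∀ u → ¬ InClosedNbhd G a u → InClosedNbhd G c u → degree G a < degree G c
  covers-adjacent⇒degree-< {a} {c} c∼a ca = degree-mono-<-closed N̄a⊆N̄c
    where
    N̄a⊆N̄c : closedNbhd a ⊆ᵇ closedNbhd c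
    N̄a⊆N̄c i i∈N̄a with Equivalence.to (closedNbhd-spec a i) i∈N̄a
    ... | inj₁ refl = Equivalence.from (closedNbhd-spec c a) (inj₂ (∼-sym c∼a))
    ... | inj₂ i∼a  = Equivalence.from (closedNbhd-spec c i) (ca i i∼a)

  covers-nonadjacent⇒degree-< : ∀ {a c} → ¬ c ∼[ G ] a → Covers c a →
    ∀ u → ¬ a ∼[ G ] u → c ∼[ G ] u → degree G a < degree G c
  covers-nonadjacent⇒degree-< {a} {c} c≁a ca = degree-mono-< Na⊆Nc
    where
    Na⊆Nc : adj G a ⊆ᵇ adj G c
    Na⊆Nc i a∼i with ca i (∼-sym a∼i)
    ... | inj₁ refl = ⊥-elim (c≁a (∼-sym a∼i))
    ... | inj₂ i∼c  = ∼-sym i∼c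

  CommonCover⇒degree-< : ∀ {a b c} → ¬ a ∼[ G ] b → Covers c a → Covers c b →
    ∀ {v} → v ∼[ G ] b → ¬ InClosedNbhd G a v → degree G a < degree G c
  CommonCover⇒degree-< {a} {b} {c} a≁b ca cb {v} v∼b v∉N̄a with T? (adj G c a) | cb v v∼b
  ... | yes c∼a | v∈N̄c      = covers-adjacent⇒degree-< c∼a ca v v∉N̄a v∈N̄c
  ... | no  c≁a | inj₁ refl = covers-nonadjacent⇒degree-< c≁a ca b a≁b v∼b
  ... | no  c≁a | inj₂ v∼c  =
    covers-nonadjacent⇒degree-< c≁a ca v (v∉N̄a ∘ inj₂ ∘ ∼-sym) (∼-sym v∼c)

  maxDegree-covers : Star G → ∀ {x} → MaxDegree G x →
    ∀ {b} → b ≢ x → ¬ x ∼[ G ] b → Covers x b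
  maxDegree-covers star {x} x-max {b} b≢x x≁b v v∼b with inClosedNbhd? x v
  ... | yes v∈N̄x = v∈N̄x
  ... | no  v∉N̄x with Star⇒CommonCover star (≢-sym b≢x) x≁b
  ... | c , cx , cb = ⊥-elim (<⇒≱ (CommonCover⇒degree-< x≁b cx cb v∼b v∉N̄x) (x-max c))

module _ {n : ℕ} (G : Graph n) (x : Fin n) where

  private
    H = addPendant G x

  lift-closedNbhd : ∀ {c u} → InClosedNbhd G c u → InClosedNbhd H (suc c) (suc u)
  lift-closedNbhd = Sum.map (cong suc) id

  lift-covers : ∀ {b c} → b ≢ x → Covers G c b → Covers H (suc c) (suc b)
  lift-covers b≢x cb zero    w∼b = ⊥-elim (b≢x (toWitness w∼b))
  lift-covers b≢x cb (suc u) u∼b = lift-closedNbhd (cb u u∼b)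

  pendant-covered-by-x : Covers H (suc x) zero
  pendant-covered-by-x (suc u) u∼w = inj₁ (cong suc (toWitness u∼w))

  pendant-covered-by-neighbour : ∀ {b} → x ∼[ G ] b → Covers H (suc b) zero
  pendant-covered-by-neighbour x∼b (suc u) u∼w with toWitness u∼w
  ... | refl = inj₂ x∼b

  module _ (star : Star G) (x-max : MaxDegree G x) where

    pendant-pair : ∀ {b} → b ≢ x → CommonCover H zero (suc b)
    pendant-pair {b} b≢x with T? (adj G x b)
    ... | yes x∼b = suc b , pendant-covered-by-neighbour x∼b , covers-self H (suc b)
    ... | no  x≁b = suc x , pendant-covered-by-x ,
                    lift-covers b≢x (maxDegree-covers G star x-max b≢x x≁b)

    max-pair : ∀ {b} → b ≢ x → ¬ x ∼[ G ] b → CommonCover H (suc x) (suc b)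
    max-pair b≢x x≁b =
      suc x , covers-self H (suc x) , lift-covers b≢x (maxDegree-covers G star x-max b≢x x≁b)

    old-pair : ∀ {a b} → a ≢ b → ¬ a ∼[ G ] b → CommonCover H (suc a) (suc b)
    old-pair {a} {b} a≢b a≁b with a ≟ x | b ≟ x
    ... | yes refl | yes refl = ⊥-elim (a≢b refl)
    ... | yes refl | no  b≢x  = max-pair b≢x a≁b
    ... | no  a≢x  | yes refl = CommonCover-swap H (max-pair a≢x (a≁b ∘ ∼-sym G))
    ... | no  a≢x  | no  b≢x  with Star⇒CommonCover G star a≢b a≁b
    ... | c , ca , cb = suc c , lift-covers a≢x ca , lift-covers b≢x cb

    addPendant-star : Star H
    addPendant-star = CommonCover⇒Star H λ where
      zero    zero    w≢w _   → ⊥-elim (w≢w refl)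
      zero    (suc b) _   w≁b → pendant-pair (w≁b ∘ fromWitness)
      (suc a) zero    _   a≁w → CommonCover-swap H (pendant-pair (a≁w ∘ fromWitness))
      (suc a) (suc b) a≢b a≁b → old-pair (a≢b ∘ cong suc) a≁b

mainTheorem8 : (n : ℕ) (G : Graph n) → Connected G → Star G →
    (x : Fin n) → MaxDegree G x → Star (addPendant G x)
mainTheorem8 n G _ star x x-max = addPendant-star G x star x-max
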